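{- Let $\mathcal{C}\subseteq[q]^{\tilde{n}}$ be an $(\tilde{n},k,\tilde{d})_q$ error-correcting code (with $q^k$ codewords and minimum Hamming distance $\tilde{d}$), and let $u>0$ and $e\ge 0$ be integers. Let $\varphi\colon[q]\to\{0,1\}^{q^u}$ map $x$ to the vector, with coordinates indexed by $[q]^u$, having a $1$ at position $(a_1,\dots,a_u)$ if and only if $a_i=x$ for some $i\in[u]$. Let $M'$ be the $\tilde{n}\times q^k$ matrix over $[q]$ whose columns are the codewords of $\mathcal{C}$, and let $M$ be the $m\times n$ Boolean matrix ($n=q^k$, $m=\tilde{n}q^u$) obtained by replacing each entry $x$ of $M'$ by the column vector $\varphi(x)$. Then $M$ is strongly $(d,e;u)$-disjunct for every $d < (\tilde{n}-e)/((\tilde{n}-\tilde{d})u)$.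
   Context: A Boolean matrix (with at least $d+u$ columns) is strongly $(d,e;u)$-disjunct if for every choice of $d+u$ distinct columns $C_1,\dots,C_u,C_1',\dots,C_d'$ we have $\big|\bigcap_{i=1}^u \mathrm{supp}(C_i) \setminus \bigcup_{i=1}^d \mathrm{supp}(C_i')\big| > e$, where $\mathrm{supp}$ of a column is the set of row indices where it equals $1$. -}

module Defs where

open import Data.Nat using (ℕ; _+_; _*_; _^_; _<_)
open import Data.Bool using (Bool; not)
open import Data.Fin using (Fin; _↑ˡ_; _↑ʳ_; remQuot; finToFun)
open import Data.Fin.Properties using (any?) renaming (_≟_ to _≟F_)
open import Data.Fin.Subset using (Subset; ⋂; ⋃; _─_; ∣_∣)
open import Data.Vec using (tabulate)
import Data.List as L
open import Data.Product using (Σ; _×_; _,_; proj₁; proj₂)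
open import Relation.Nullary.Decidable using (⌊_⌋)
open import Relation.Binary.PropositionalEquality using (_≡_; _≢_)
open import Function.Definitions using (Injective)

BoolMatrix : ℕ → ℕ → Set
BoolMatrix m n = Fin m → Fin n → Bool

supp : ∀ {m n} → BoolMatrix m n → Fin n → Subset m
supp M c = tabulate (λ r → M r c)

-- Strongly (d,e;u)-disjunct: for every choice of d+u distinct columns
-- C_1..C_u (= C (i ↑ˡ d)) and C'_1..C'_d (= C (u ↑ʳ j)),
-- | ⋂_i supp C_i  \  ⋃_j supp C'_j | > e.
StronglyDisjunct : ∀ {m n} → (d e u : ℕ) → BoolMatrix m n → Set
StronglyDisjunct {m} {n} d e u M =
  (C : Fin (u + d) → Fin n) → Injective _≡_ _≡_ C →
  e < ∣ ⋂ (L.tabulate (λ (i : Fin u) → supp M (C (i ↑ˡ d))))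
        ─ ⋃ (L.tabulate (λ (j : Fin d) → supp M (C (u ↑ʳ j)))) ∣

QMatrix : ℕ → ℕ → ℕ → Set
QMatrix q ñ N = Fin ñ → Fin N → Fin q

hamming : ∀ {q ñ N} → QMatrix q ñ N → Fin N → Fin N → ℕ
hamming M' c c' = ∣ tabulate (λ i → not ⌊ M' i c ≟F M' i c' ⌋) ∣

IsCode : (q ñ k d̃ : ℕ) → QMatrix q ñ (q ^ k) → Set
IsCode q ñ k d̃ M' =
  ((c c' : Fin (q ^ k)) → (∀ i → M' i c ≡ M' i c') → c ≡ c')
  × ((c c' : Fin (q ^ k)) → c ≢ c' → d̃ Data.Nat.≤ hamming M' c c')
  × Σ (Fin (q ^ k)) (λ c → Σ (Fin (q ^ k)) (λ c' → c ≢ c' × hamming M' c c' ≡ d̃))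

-- φ : [q] → {0,1}^{q^u}; coordinates in Fin (q^u) are identified with
-- tuples (a_1..a_u) ∈ [q]^u via the library bijection finToFun.
φ : ∀ {q} (u : ℕ) → Fin q → Fin (q ^ u) → Bool
φ {q} u x a = ⌊ any? (λ i → finToFun {q} {u} a i ≟F x) ⌋

-- M: row index r ∈ Fin (ñ * q^u) is decoded as the pair (i , a) with
-- i ∈ Fin ñ (row of M') and a ∈ Fin (q^u) (coordinate of φ), i.e.
-- row block i of M is the column vector φ(M' i c).
expand : ∀ {q ñ N} (u : ℕ) → QMatrix q ñ N → BoolMatrix (ñ * q ^ u) N
expand {q} u M' r c with remQuot (q ^ u) r
... | (i , a) = φ u (M' i c) a

-- Two distinct codewords agree in at most ñ − d̃ coordinates, so at most
-- d·u·(ñ − d̃) coordinates r are conflicted, i.e. have C_i(r) = C'_j(r) for some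
-- i, j; by hypothesis more than e coordinates are not.  For such an r, the row
-- of M in block r indexed by the tuple a = (C_1(r), …, C_u(r)) ∈ [q]^u is 1 in
-- every C_i (φ(C_i(r)) sees its own value in a) and 0 in every C'_j (no C'_j(r)
-- occurs in a).  Different coordinates give different rows of M.
module Submission where

open import Data.Bool using (Bool; true; false; not)
open import Data.Empty using (⊥-elim)
open import Data.Fin using (Fin; zero; suc; _↑ˡ_; _↑ʳ_; combine; finToFun; funToFin)
open import Data.Fin.Properties
  using (any?; suc-injective; 0≢1+n; remQuot-combine; combine-injectiveˡ; finToFun-funToFin)
  renaming (_≟_ to _≟F_)
open import Data.Fin.Subset using (Subset; inside; outside; _∈_; _∉_; _∪_; _─_; _-_; ∁; ⋂; ⋃; ∣_∣)
open import Data.Fin.Subset.Properties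
  using (∈⊤; ∉⊥; x∈p∩q⁺; x∈p∪q⁺; x∈p∪q⁻; x∈p∧x∉q⇒x∈p─q; x∈p∧x≢y⇒x∈p-y; x∈∁p⇒x∉p;
         x∈p⇒∣p-x∣<∣p∣; ∣p∣≤∣x∷p∣; ∣⊥∣≡0; ∣p∣≤n; ∣∁p∣≡n∸∣p∣)
import Data.List as L
open import Data.Nat as ℕ using (ℕ; _+_; _*_; _∸_; _^_; _<_; _≤_; z≤n; s≤s)
open import Data.Nat.Properties
  using (≤-trans; ≤-reflexive; +-suc; +-comm; *-comm; +-mono-≤; +-monoʳ-≤; ∸-monoʳ-≤; m∸[m∸n]≡n; m+n≤o⇒m≤o∸n; module ≤-Reasoning)
open import Data.Product using (∃; _,_)
open import Data.Sum using (inj₁; inj₂)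
open import Data.Vec using ([]; _∷_; tabulate; here; there)
open import Data.Vec.Properties using (lookup∘tabulate; lookup⇒[]=; []=⇒lookup; tabulate-∘)
open import Function using (_∘_)
open import Function.Definitions using (Injective)
open import Relation.Binary.PropositionalEquality
open import Relation.Nullary using (yes; no; contradiction)
open import Relation.Nullary.Decidable using (⌊_⌋; isYes≗does; dec-true)

open import Defs

↑ˡ≢↑ʳ : ∀ {m n} (i : Fin m) (j : Fin n) → i ↑ˡ n ≢ m ↑ʳ j
↑ˡ≢↑ʳ zero    j ()
↑ˡ≢↑ʳ (suc i) j eq = ↑ˡ≢↑ʳ i j (suc-injective eq)

x∈tabulate⁺ : ∀ {n} {f : Fin n → Bool} {x} → f x ≡ true → x ∈ tabulate f
x∈tabulate⁺ {f = f} {x} fx≡true = lookup⇒[]= x (tabulate f) (trans (lookup∘tabulate f x) fx≡true)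

x∈tabulate⁻ : ∀ {n} {f : Fin n → Bool} {x} → x ∈ tabulate f → f x ≡ true
x∈tabulate⁻ {f = f} {x} x∈ = trans (sym (lookup∘tabulate f x)) ([]=⇒lookup x∈)

x∈⋂tabulate⁺ : ∀ {m n} {x : Fin n} (f : Fin m → Subset n) → (∀ i → x ∈ f i) → x ∈ ⋂ (L.tabulate f)
x∈⋂tabulate⁺ {ℕ.zero}  f x∈f = ∈⊤
x∈⋂tabulate⁺ {ℕ.suc m} f x∈f = x∈p∩q⁺ (x∈f zero , x∈⋂tabulate⁺ (f ∘ suc) (x∈f ∘ suc))

x∈⋃tabulate⁺ : ∀ {m n} {x : Fin n} (f : Fin m → Subset n) i → x ∈ f i → x ∈ ⋃ (L.tabulate f)
x∈⋃tabulate⁺ f zero    x∈fi = x∈p∪q⁺ (inj₁ x∈fi)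
x∈⋃tabulate⁺ f (suc i) x∈fi = x∈p∪q⁺ (inj₂ (x∈⋃tabulate⁺ (f ∘ suc) i x∈fi))

x∈⋃tabulate⁻ : ∀ {m n} {x : Fin n} (f : Fin m → Subset n) → x ∈ ⋃ (L.tabulate f) → ∃ λ i → x ∈ f i
x∈⋃tabulate⁻ {ℕ.zero}  f x∈⊥ = ⊥-elim (∉⊥ x∈⊥)
x∈⋃tabulate⁻ {ℕ.suc m} f x∈⋃ with x∈p∪q⁻ (f zero) _ x∈⋃
... | inj₁ x∈f0   = zero , x∈f0
... | inj₂ x∈rest with i , x∈fi ← x∈⋃tabulate⁻ (f ∘ suc) x∈rest = suc i , x∈fi

∣p∪q∣≤∣p∣+∣q∣ : ∀ {n} (p q : Subset n) → ∣ p ∪ q ∣ ≤ ∣ p ∣ + ∣ q ∣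
∣p∪q∣≤∣p∣+∣q∣ []            []            = z≤n
∣p∪q∣≤∣p∣+∣q∣ (inside  ∷ p) (y ∷ q)       =
  s≤s (≤-trans (∣p∪q∣≤∣p∣+∣q∣ p q) (+-monoʳ-≤ ∣ p ∣ (∣p∣≤∣x∷p∣ y q)))
∣p∪q∣≤∣p∣+∣q∣ (outside ∷ p) (inside  ∷ q) =
  ≤-trans (s≤s (∣p∪q∣≤∣p∣+∣q∣ p q)) (≤-reflexive (sym (+-suc ∣ p ∣ ∣ q ∣)))
∣p∪q∣≤∣p∣+∣q∣ (outside ∷ p) (outside ∷ q) = ∣p∪q∣≤∣p∣+∣q∣ p q

∣⋃tabulate∣≤ : ∀ {m n} (f : Fin m → Subset n) {b} → (∀ i → ∣ f i ∣ ≤ b) → ∣ ⋃ (L.tabulate f) ∣ ≤ m * b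
∣⋃tabulate∣≤ {ℕ.zero}  {n} f ∣f∣≤b = ≤-reflexive (∣⊥∣≡0 n)
∣⋃tabulate∣≤ {ℕ.suc m}     f ∣f∣≤b = ≤-trans (∣p∪q∣≤∣p∣+∣q∣ (f zero) _)
  (+-mono-≤ (∣f∣≤b zero) (∣⋃tabulate∣≤ (f ∘ suc) (∣f∣≤b ∘ suc)))

injection⇒∣p∣≤∣q∣ : ∀ {m n} (p : Subset m) {q : Subset n} (f : Fin m → Fin n) →
  Injective _≡_ _≡_ f → (∀ {x} → x ∈ p → f x ∈ q) → ∣ p ∣ ≤ ∣ q ∣
injection⇒∣p∣≤∣q∣ []            f f-inj f∈q = z≤n
injection⇒∣p∣≤∣q∣ (outside ∷ p) f f-inj f∈q =
  injection⇒∣p∣≤∣q∣ p (f ∘ suc) (suc-injective ∘ f-inj) (f∈q ∘ there)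
injection⇒∣p∣≤∣q∣ (inside ∷ p) {q} f f-inj f∈q = begin-strict
  ∣ p ∣              ≤⟨ injection⇒∣p∣≤∣q∣ p (f ∘ suc) (suc-injective ∘ f-inj) f∘suc∈q-f0 ⟩
  ∣ q - f zero ∣     <⟨ x∈p⇒∣p-x∣<∣p∣ (f∈q here) ⟩
  ∣ q ∣              ∎
  where
  open ≤-Reasoning
  f∘suc∈q-f0 : ∀ {x} → x ∈ p → f (suc x) ∈ q - f zero
  f∘suc∈q-f0 x∈p = x∈p∧x≢y⇒x∈p-y (f∈q (there x∈p)) (0≢1+n ∘ sym ∘ f-inj)

φ-funToFin-hit : ∀ {q u} (g : Fin u → Fin q) {x} j → g j ≡ x → φ u x (funToFin g) ≡ true
φ-funToFin-hit {q} {u} g {x} j gj≡x with any? (λ i → finToFun {q} {u} (funToFin g) i ≟F x)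
... | yes _ = refl
... | no ∄  = contradiction (j , trans (finToFun-funToFin g j) gj≡x) ∄

φ-funToFin-miss : ∀ {q u} (g : Fin u → Fin q) {x} → (∀ j → g j ≢ x) → φ u x (funToFin g) ≡ false
φ-funToFin-miss {q} {u} g {x} g≢x with any? (λ i → finToFun {q} {u} (funToFin g) i ≟F x)
... | yes (j , eq) = contradiction (trans (sym (finToFun-funToFin g j)) eq) (g≢x j)
... | no _         = refl

expand-combine : ∀ {q ñ N} u (M' : QMatrix q ñ N) i a c → expand u M' (combine i a) c ≡ φ u (M' i c) a
expand-combine {q} u M' i a c = cong (λ (i , a) → φ u (M' i c) a) (remQuot-combine {k = q ^ u} i a)

module _ {q ñ N : ℕ} (M' : QMatrix q ñ N) where

  agreement : Fin N → Fin N → Subset ñ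
  agreement c c' = tabulate (λ i → ⌊ M' i c ≟F M' i c' ⌋)

  ∈agreement : ∀ {i c c'} → M' i c ≡ M' i c' → i ∈ agreement c c'
  ∈agreement {i} {c} {c'} eq =
    x∈tabulate⁺ (trans (isYes≗does (M' i c ≟F M' i c')) (dec-true (M' i c ≟F M' i c') eq))

  ∣agreement∣≡ñ∸hamming : ∀ c c' → ∣ agreement c c' ∣ ≡ ñ ∸ hamming M' c c'
  ∣agreement∣≡ñ∸hamming c c' = begin
    ∣ agree ∣             ≡⟨ m∸[m∸n]≡n (∣p∣≤n agree) ⟨
    ñ ∸ (ñ ∸ ∣ agree ∣)   ≡⟨ cong (ñ ∸_) (∣∁p∣≡n∸∣p∣ agree) ⟨
    ñ ∸ ∣ ∁ agree ∣       ≡⟨ cong (λ p → ñ ∸ ∣ p ∣) (tabulate-∘ not (λ i → ⌊ M' i c ≟F M' i c' ⌋)) ⟨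
    ñ ∸ hamming M' c c'   ∎
    where
    open ≡-Reasoning
    agree = agreement c c'

module _ {q ñ N : ℕ} (u : ℕ) (M' : QMatrix q ñ N) {d : ℕ} (A : Fin u → Fin N) (B : Fin d → Fin N) where

  separatedRows : Subset (ñ * q ^ u)
  separatedRows = ⋂ (L.tabulate (supp (expand u M') ∘ A)) ─ ⋃ (L.tabulate (supp (expand u M') ∘ B))

  conflictRows : Subset ñ
  conflictRows = ⋃ (L.tabulate λ l → ⋃ (L.tabulate λ j → agreement M' (A j) (B l)))

  ∣conflictRows∣≤ : ∀ {b} → (∀ j l → ∣ agreement M' (A j) (B l) ∣ ≤ b) → ∣ conflictRows ∣ ≤ d * (b * u)
  ∣conflictRows∣≤ {b} ∣agreement∣≤b = ∣⋃tabulate∣≤ _ λ l →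
    ≤-trans (∣⋃tabulate∣≤ _ (λ j → ∣agreement∣≤b j l)) (≤-reflexive (*-comm u b))

  witnessRow : Fin ñ → Fin (ñ * q ^ u)
  witnessRow i = combine i (funToFin λ j → M' i (A j))

  witnessRow-separated : ∀ {i} → i ∉ conflictRows → witnessRow i ∈ separatedRows
  witnessRow-separated {i} i∉conflicts = x∈p∧x∉q⇒x∈p─q (x∈⋂tabulate⁺ _ ∈suppA) ∉⋃suppB
    where
    ∈suppA : ∀ j → witnessRow i ∈ supp (expand u M') (A j)
    ∈suppA j = x∈tabulate⁺ (trans (expand-combine u M' i _ (A j)) (φ-funToFin-hit _ j refl))
    A≢B : ∀ l j → M' i (A j) ≢ M' i (B l)
    A≢B l j eq = i∉conflicts (x∈⋃tabulate⁺ _ l (x∈⋃tabulate⁺ _ j (∈agreement M' eq)))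
    ∉⋃suppB : witnessRow i ∉ ⋃ (L.tabulate (supp (expand u M') ∘ B))
    ∉⋃suppB ∈⋃ with l , ∈suppBl ← x∈⋃tabulate⁻ _ ∈⋃ =
      contradiction (trans (sym (trans (expand-combine u M' i _ (B l)) (φ-funToFin-miss _ (A≢B l))))
                           (x∈tabulate⁻ ∈suppBl)) λ ()

  ∣∁conflictRows∣≤∣separatedRows∣ : ∣ ∁ conflictRows ∣ ≤ ∣ separatedRows ∣
  ∣∁conflictRows∣≤∣separatedRows∣ = injection⇒∣p∣≤∣q∣ (∁ conflictRows) witnessRow
    (λ {i} {i'} → combine-injectiveˡ i _ i' _) (witnessRow-separated ∘ x∈∁p⇒x∉p)

lemma4p25 : (q ñ k d̃ : ℕ) (M' : QMatrix q ñ (q ^ k)) → IsCode q ñ k d̃ M' →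
    (u e : ℕ) → 0 < u →
    (d : ℕ) → d * ((ñ ∸ d̃) * u) + e < ñ →
    StronglyDisjunct d e u (expand u M')
lemma4p25 q ñ k d̃ M' (_ , distance , _) u e _ d d[ñ∸d̃]u+e<ñ C C-inj = begin-strict
  e                              <⟨ m+n≤o⇒m≤o∸n (ℕ.suc e) e+∣conflicts∣<ñ ⟩
  ñ ∸ ∣ conflicts ∣              ≡⟨ ∣∁p∣≡n∸∣p∣ conflicts ⟨
  ∣ ∁ conflicts ∣                ≤⟨ ∣∁conflictRows∣≤∣separatedRows∣ u M' A B ⟩
  ∣ separatedRows u M' A B ∣     ∎
  where
  open ≤-Reasoning
  A : Fin u → Fin (q ^ k)
  A j = C (j ↑ˡ d)
  B : Fin d → Fin (q ^ k)
  B l = C (u ↑ʳ l)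
  conflicts = conflictRows u M' A B
  ∣agreement∣≤ñ∸d̃ : ∀ j l → ∣ agreement M' (A j) (B l) ∣ ≤ ñ ∸ d̃
  ∣agreement∣≤ñ∸d̃ j l = begin
    ∣ agreement M' (A j) (B l) ∣   ≡⟨ ∣agreement∣≡ñ∸hamming M' (A j) (B l) ⟩
    ñ ∸ hamming M' (A j) (B l)     ≤⟨ ∸-monoʳ-≤ ñ (distance (A j) (B l) (↑ˡ≢↑ʳ j l ∘ C-inj)) ⟩
    ñ ∸ d̃                          ∎
  e+∣conflicts∣<ñ : e + ∣ conflicts ∣ < ñ
  e+∣conflicts∣<ñ = begin-strict
    e + ∣ conflicts ∣               ≤⟨ +-monoʳ-≤ e (∣conflictRows∣≤ u M' A B ∣agreement∣≤ñ∸d̃) ⟩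
    e + d * ((ñ ∸ d̃) * u)           ≡⟨ +-comm e _ ⟩
    d * ((ñ ∸ d̃) * u) + e           <⟨ d[ñ∸d̃]u+e<ñ ⟩
    ñ                               ∎
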